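{- Let $a,b,k$ be integers with $k\ge b>a\ge1$. For $m\ge1$ let $\mathcal{BR}'_{a,b,k}(m)$ be the set of partitions $\lambda=(\lambda_1,\dots,\lambda_m)$ with exactly $m$ parts, all parts congruent to $a$ or $b$ modulo $k$, only parts congruent to $b$ modulo $k$ repeated, such that $\lambda_m\in\{a,b\}$ and, for $1\le i<m$, $\lambda_i-\lambda_{i+1}\le k$ with strict inequality if $\lambda_{i+1}\equiv b\pmod k$. For $m\ge 2$ and $0\le h\le m-2$ let $\mathcal{BR}'_{a,b,k}(m,h,a)$ (resp. $\mathcal{BR}'_{a,b,k}(m,h,b)$) be the set of $\lambda\in\mathcal{BR}'_{a,b,k}(m)$ with largest part $k(h+1)+a$ (resp. $kh+b$). Then for $m\ge2$ and $0\le h\le m-2$, \[\sum_{\lambda\in\mathcal{BR}'_{a,b,k}(m,h,a)}u^{\ell_a(\lambda)}v^{\ell_b(\lambda)}q^{|\lambda|}=(uq^a+vq^b)u^{h+1}v^{m-h-2}q^{(m-1)b+k\binom{h+1}{2}+(k-b+a)(h+1)}{{m-2}\brack h}_k,\] \[\sum_{\lambda\in\mathcal{BR}'_{a,b,k}(m,h,b)}u^{\ell_a(\lambda)}v^{\ell_b(\lambda)}q^{|\lambda|}=(uq^a+vq^b)u^{h}v^{m-h-1}q^{(m-1)b+k\binom{h+1}{2}+(k-b+a)h}{{m-2}\brack h}_k.\]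
   Context: A partition is a finite non-increasing sequence of positive integers; $|\lambda|$ is the sum of its parts; $\ell_a(\lambda)$, $\ell_b(\lambda)$ are the numbers of parts congruent to $a$, resp. $b$, modulo $k$. $(x;q)_n=\prod_{i=0}^{n-1}(1-xq^i)$, and ${A\brack B}_k=\frac{(q^k;q^k)_A}{(q^k;q^k)_B(q^k;q^k)_{A-B}}$ for $A\ge B\ge0$, $0$ otherwise. -}

module Defs where

open import Level using (Level)
open import Data.Bool using (Bool; true; false; _∧_; _∨_; if_then_else_)
open import Data.Nat using (ℕ; zero; suc; _∸_; _≡ᵇ_; _≤ᵇ_; _<ᵇ_; _%_) renaming (_+_ to _+ℕ_; _*_ to _*ℕ_)
open import Data.List using (List; []; _∷_; length; map; filter; foldr; concatMap; upTo)
open import Relation.Binary.PropositionalEquality using (_≡_)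
open import Relation.Nullary.Decidable using (Dec; yes; no)
open import Algebra.Bundles using (CommutativeRing)

-- Partitions are represented as lists of natural numbers written in
-- non-increasing order: λ = λ₁ ∷ λ₂ ∷ … ∷ λₘ ∷ [] (head = largest part).

_≡[_]ᵇ_ : ℕ → ℕ → ℕ → Bool
x ≡[ zero  ]ᵇ y = x ≡ᵇ y
x ≡[ suc k ]ᵇ y = (x % suc k) ≡ᵇ (y % suc k)

allPos : List ℕ → Bool
allPos []       = true
allPos (x ∷ xs) = (1 ≤ᵇ x) ∧ allPos xs

partsOK : ℕ → ℕ → ℕ → List ℕ → Bool
partsOK a b k []       = true
partsOK a b k (x ∷ xs) = ((x ≡[ k ]ᵇ a) ∨ (x ≡[ k ]ᵇ b)) ∧ partsOK a b k xs

adjOK : ℕ → ℕ → ℕ → List ℕ → Bool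
adjOK a b k []               = false
adjOK a b k (x ∷ [])         = (x ≡ᵇ a) ∨ (x ≡ᵇ b)
adjOK a b k (x ∷ y ∷ ys) =
  (y ≤ᵇ x)
  ∧ (if x ≡ᵇ y then (x ≡[ k ]ᵇ b) else true)
  ∧ (if y ≡[ k ]ᵇ b then (x ∸ y <ᵇ k) else (x ∸ y ≤ᵇ k))
  ∧ adjOK a b k (y ∷ ys)

largest : List ℕ → ℕ
largest []      = 0
largest (x ∷ _) = x

isBR' : ℕ → ℕ → ℕ → ℕ → List ℕ → Bool
isBR' a b k m xs = (length xs ≡ᵇ m) ∧ allPos xs ∧ partsOK a b k xs ∧ adjOK a b k xs

isBR'top : ℕ → ℕ → ℕ → ℕ → ℕ → List ℕ → Bool
isBR'top a b k m N xs = isBR' a b k m xs ∧ (largest xs ≡ᵇ N)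

lists : ℕ → ℕ → List (List ℕ)
lists zero    N = [] ∷ []
lists (suc m) N = concatMap (λ x → map (x ∷_) (lists m N)) (upTo (suc N))

BR'top : ℕ → ℕ → ℕ → ℕ → ℕ → List (List ℕ)
BR'top a b k m N = filter (λ xs → T? (isBR'top a b k m N xs)) (lists m N)
  where
  open import Data.Bool using (T)
  open import Relation.Nullary.Decidable using (Dec)
  T? : (x : Bool) → Dec (T x)
  T? true  = yes _
  T? false = no (λ ())

size : List ℕ → ℕ
size = foldr _+ℕ_ 0

countMod : ℕ → ℕ → List ℕ → ℕ
countMod k c []       = 0
countMod k c (x ∷ xs) = (if x ≡[ k ]ᵇ c then 1 else 0) +ℕ countMod k c xs

-- Ring-valued expressions (u, v, q are arbitrary elements of a
-- commutative ring; in particular the indeterminates of ℤ[u,v,q]).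

module RingDefs {c ℓ : Level} (R : CommutativeRing c ℓ) where
  open CommutativeRing R

  pow : Carrier → ℕ → Carrier
  pow x zero    = 1#
  pow x (suc n) = x * pow x n

  ringSum : List Carrier → Carrier
  ringSum = foldr _+_ 0#

  qPoch : Carrier → ℕ → ℕ → Carrier
  qPoch q k zero    = 1#
  qPoch q k (suc n) = qPoch q k n * (1# - pow q (k *ℕ suc n))

  weight : ℕ → ℕ → ℕ → Carrier → Carrier → Carrier → List ℕ → Carrier
  weight a b k u v q xs =
    pow u (countMod k a xs) * pow v (countMod k b xs) * pow q (size xs)

  genFun : ℕ → ℕ → ℕ → ℕ → ℕ → Carrier → Carrier → Carrier → Carrier
  genFun a b k m N u v q = ringSum (map (weight a b k u v q) (BR'top a b k m N))

{-# OPTIONS --safe #-}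

-- Read from its largest part downwards, a partition in BR′_{a,b,k}(m) walks through the
-- levels a < b < k+a < k+b < 2k+a < …: the gap conditions force the part jk+a (j ≥ 1) to be
-- followed by (j-1)k+a or (j-1)k+b, the part jk+b by jk+a or jk+b, and the part a to be
-- the last one.  So the generating functions A_n(j), B_n(j) of such partitions with n+1
-- parts and largest part jk+a, resp. jk+b, satisfy
--   A_{n+1}(j+1) = u q^{(j+1)k+a} (A_n(j) + B_n(j)),   B_{n+1}(j) = v q^{jk+b} (A_n(j) + B_n(j)),
-- and C_n(j) = A_n(j) + B_n(j) obeys the q-Pascal recurrence of the Gaussian binomials in
-- base q^k.  By induction C_n(j) = (uq^a + vq^b) u^j v^{n-j} q^{ja + k C(j+1,2) + (n-j)b} [n j]_k;
-- one more step of the recurrence gives A_{n+1}(h+1) and B_{n+1}(h), and multiplying by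
-- (q^k;q^k)_h (q^k;q^k)_{n-h} turns [n h]_k into (q^k;q^k)_n.

module Submission where

open import Defs
open import Level using (Level)
open import Data.Nat using (ℕ; _∸_; _≤_; _<_) renaming (_+_ to _+ℕ_; _*_ to _*ℕ_)
open import Data.Nat.Combinatorics using (_C_; nCk+nC[k+1]≡[n+1]C[k+1]; nC1≡n)
open import Data.Product using (_×_)
open import Algebra.Bundles using (CommutativeRing)

open import Data.Nat using (zero; suc; s≤s; z≤n; _≡ᵇ_; _≤ᵇ_; _<ᵇ_; _%_; _/_)
open import Data.Nat.Properties
  using (_≤?_; suc-injective; ≡ᵇ⇒≡; ≡⇒≡ᵇ; ≤ᵇ⇒≤; ≤⇒≤ᵇ; <ᵇ⇒<; <⇒<ᵇ;
         ≤-refl; ≤-reflexive; ≤-trans; ≤-antisym; ≤-pred; <-trans; <-irrefl; <⇒≤; <⇒≢; ≤-<-trans; <-≤-trans;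
         ≤∧≢⇒<; m≤n⇒m<n∨m≡n; ≰⇒>; n<1+n; n≮0; m<n⇒m<1+n; m<n+m; m<m+n; m≤n+m; m≤n+m∸n;
         m<n+o⇒m∸n<o; m≤n+o⇒m∸n≤o; m∸n+n≡m; m+[n∸m]≡n; +-∸-assoc; ∸-+-assoc;
         +-monoʳ-<; +-monoʳ-≤; +-monoˡ-≤; *-monoˡ-≤; +-cancelʳ-<; +-cancelʳ-≤; *-cancelʳ-<; *-cancelʳ-≤)
import Data.Nat.Properties as ℕₚ
open import Data.Nat.DivMod using (m≡m%n+[m/n]*n; [m+kn]%n≡m%n; m<n⇒m%n≡m; n%n≡0)
open import Data.Nat.Tactic.RingSolver using (solve-∀; solve)
open import Data.Bool using (Bool; true; false; T; T?; _∧_; _∨_; if_then_else_)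
open import Data.Bool.Properties using (T-∧; T-∨; ∧-zeroʳ; ∧-comm)
open import Data.List using (List; []; _∷_; map; concatMap; filter; length; _++_; applyUpTo; upTo)
open import Data.Product using (∃-syntax; _,_; proj₁; proj₂)
open import Data.Sum using (_⊎_; inj₁; inj₂; [_,_]′)
open import Data.Unit using (tt)
open import Data.Empty using (⊥-elim)
open import Function.Base using (id; _∘_)
open import Function.Bundles using (Equivalence; _⇔_; mk⇔)
open import Relation.Nullary using (Dec; yes; no; ¬_)
open import Relation.Binary.PropositionalEquality as ≡ using (_≡_; _≢_)

open Equivalence using (to; from)

if-T : ∀ {ℓ} {A : Set ℓ} {c : Bool} {x y : A} → T c → (if c then x else y) ≡ x
if-T {c = true} _ = ≡.refl

if-¬T : ∀ {ℓ} {A : Set ℓ} {c : Bool} {x y : A} → ¬ T c → (if c then x else y) ≡ y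
if-¬T {c = true}  ¬c = ⊥-elim (¬c tt)
if-¬T {c = false} _  = ≡.refl

T-if-≡ᵇ : ∀ x y {p} → (x ≡ y → T p) → T (if x ≡ᵇ y then p else true)
T-if-≡ᵇ x y h with x ≡ᵇ y in eq
... | true  = h (≡ᵇ⇒≡ x y (≡.subst T (≡.sym eq) tt))
... | false = tt

T-if-≡ᵇ⁻ : ∀ x y {p} → T (if x ≡ᵇ y then p else true) → x ≡ y → T p
T-if-≡ᵇ⁻ x y t ≡.refl = ≡.subst T (if-T (≡⇒≡ᵇ x x ≡.refl)) t

T⇒∧-identityˡ : ∀ {p} q → T p → p ∧ q ≡ q
T⇒∧-identityˡ {true} q _ = ≡.refl

T-∧-∧⇒T-∧ : ∀ p p′ q q′ w → T ((p ∧ p′) ∧ ((q ∧ q′) ∧ w)) → T (p ∧ q)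
T-∧-∧⇒T-∧ true  true  true  q′ w _ = tt
T-∧-∧⇒T-∧ true  true  false q′ w ()
T-∧-∧⇒T-∧ true  false q     q′ w ()
T-∧-∧⇒T-∧ false p′    q     q′ w ()

∧-shuffle : ∀ p q r s t p′ q′ w →
  (p ∧ p′) ∧ ((q ∧ q′) ∧ (r ∧ s ∧ t ∧ w)) ≡ ((p ∧ q) ∧ (r ∧ s ∧ t)) ∧ (p′ ∧ q′ ∧ w)
∧-shuffle false q     r     s     t     p′ q′ w = ≡.refl
∧-shuffle true  false r     s     t     p′ q′ w = ∧-zeroʳ p′
∧-shuffle true  true  false s     t     p′ q′ w = ≡.trans (≡.cong (p′ ∧_) (∧-zeroʳ q′)) (∧-zeroʳ p′)
∧-shuffle true  true  true  false t     p′ q′ w = ≡.trans (≡.cong (p′ ∧_) (∧-zeroʳ q′)) (∧-zeroʳ p′)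
∧-shuffle true  true  true  true  false p′ q′ w = ≡.trans (≡.cong (p′ ∧_) (∧-zeroʳ q′)) (∧-zeroʳ p′)
∧-shuffle true  true  true  true  true  p′ q′ w = ≡.refl

∧-true-shuffle : ∀ p q r → (p ∧ true) ∧ ((q ∧ true) ∧ r) ≡ (p ∧ q) ∧ r
∧-true-shuffle false q     r = ≡.refl
∧-true-shuffle true  false r = ≡.refl
∧-true-shuffle true  true  r = ≡.refl

m∸n<o⇒m<n+o : ∀ {m n o} → m ∸ n < o → m < n +ℕ o
m∸n<o⇒m<n+o {m} {n} h = ≤-<-trans (m≤n+m∸n m n) (+-monoʳ-< n h)

m∸n≤o⇒m≤n+o : ∀ {m n o} → m ∸ n ≤ o → m ≤ n +ℕ o
m∸n≤o⇒m≤n+o {m} {n} h = ≤-trans (m≤n+m∸n m n) (+-monoʳ-≤ n h)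

level+K : ∀ i K r → i *ℕ K +ℕ r +ℕ K ≡ suc i *ℕ K +ℕ r
level+K = solve-∀

C2-suc : ∀ j → (suc j +ℕ 1) C 2 ≡ suc j +ℕ (j +ℕ 1) C 2
C2-suc j = ≡.trans (≡.sym (nCk+nC[k+1]≡[n+1]C[k+1] (j +ℕ 1) 1))
                   (≡.cong (_+ℕ (j +ℕ 1) C 2) (≡.trans (nC1≡n (j +ℕ 1)) (ℕₚ.+-comm j 1)))

-- Identities for the exponent  j a + C(j+1,2) K + (n ∸ j) b  of ClosedForm.closed.  They are
-- stated unfolded and outside the parametrised modules because the reflective solver only
-- works there, after `with` has generalised the atoms C(j+1,2), n ∸ j and K ∸ b.
exponent-step-aPart : ∀ a b K n j →
  (suc j *ℕ K +ℕ a) +ℕ (j *ℕ a +ℕ ((j +ℕ 1) C 2) *ℕ K +ℕ (n ∸ j) *ℕ b)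
    ≡ suc j *ℕ a +ℕ ((suc j +ℕ 1) C 2) *ℕ K +ℕ (n ∸ j) *ℕ b
exponent-step-aPart a b K n j with (suc j +ℕ 1) C 2 | (j +ℕ 1) C 2 | C2-suc j | n ∸ j
... | _ | c | ≡.refl | t = solve (a ∷ b ∷ K ∷ j ∷ c ∷ t ∷ [])

exponent-step-bPart : ∀ a b K n j → suc j ≤ n →
  (suc j *ℕ K +ℕ b) +ℕ (suc j *ℕ a +ℕ ((suc j +ℕ 1) C 2) *ℕ K +ℕ (n ∸ suc j) *ℕ b)
    ≡ (suc j *ℕ a +ℕ ((suc j +ℕ 1) C 2) *ℕ K +ℕ (n ∸ j) *ℕ b) +ℕ K *ℕ suc j
exponent-step-bPart a b K n j j<n with (suc j +ℕ 1) C 2 | n ∸ j | n ∸ suc j | +-∸-assoc 1 j<n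
... | c | _ | r | ≡.refl = solve (a ∷ b ∷ K ∷ j ∷ c ∷ r ∷ [])

exponent-top-aPart : ∀ a b K n h → b ≤ K → h ≤ n →
  suc n *ℕ b +ℕ K *ℕ ((h +ℕ 1) C 2) +ℕ (K ∸ b +ℕ a) *ℕ (h +ℕ 1)
    ≡ (suc h *ℕ K +ℕ a) +ℕ (h *ℕ a +ℕ ((h +ℕ 1) C 2) *ℕ K +ℕ (n ∸ h) *ℕ b)
exponent-top-aPart a b K n h b≤K h≤n with (h +ℕ 1) C 2 | K ∸ b | m∸n+n≡m b≤K | n ∸ h | m+[n∸m]≡n h≤n
... | c | d | ≡.refl | r | ≡.refl = solve (a ∷ b ∷ d ∷ h ∷ c ∷ r ∷ [])

exponent-top-bPart : ∀ a b K n h → b ≤ K → h ≤ n →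
  suc n *ℕ b +ℕ K *ℕ ((h +ℕ 1) C 2) +ℕ (K ∸ b +ℕ a) *ℕ h
    ≡ (h *ℕ K +ℕ b) +ℕ (h *ℕ a +ℕ ((h +ℕ 1) C 2) *ℕ K +ℕ (n ∸ h) *ℕ b)
exponent-top-bPart a b K n h b≤K h≤n with (h +ℕ 1) C 2 | K ∸ b | m∸n+n≡m b≤K | n ∸ h | m+[n∸m]≡n h≤n
... | c | d | ≡.refl | r | ≡.refl = solve (a ∷ b ∷ d ∷ h ∷ c ∷ r ∷ [])

module Sums {c ℓ : Level} (R : CommutativeRing c ℓ) where
  open CommutativeRing R hiding (zero)
  open RingDefs R

  sumOver : {A : Set} → List A → (A → Carrier) → Carrier
  sumOver xs f = ringSum (map f xs)

  [_]·_ : Bool → Carrier → Carrier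
  [ p ]· x = if p then x else 0#

  []·-cong : ∀ p {x y} → x ≈ y → [ p ]· x ≈ [ p ]· y
  []·-cong true  x≈y = x≈y
  []·-cong false _   = refl

  []·-∧ : ∀ p p′ {x} → [ p ∧ p′ ]· x ≡ [ p ]· [ p′ ]· x
  []·-∧ true  p′ = ≡.refl
  []·-∧ false p′ = ≡.refl

  []·-∧-* : ∀ p p′ x y → [ p ∧ p′ ]· (x * y) ≈ [ p ]· (x * [ p′ ]· y)
  []·-∧-* true  true  x y = refl
  []·-∧-* true  false x y = sym (zeroʳ x)
  []·-∧-* false p′    x y = refl

  []·-zero : ∀ p {x} → x ≈ 0# → [ p ]· x ≈ 0#
  []·-zero true  x≈0 = x≈0
  []·-zero false _   = refl

  sumOver-cong : {A : Set} (xs : List A) {f g : A → Carrier} → (∀ x → f x ≈ g x) → sumOver xs f ≈ sumOver xs g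
  sumOver-cong []       f≈g = refl
  sumOver-cong (x ∷ xs) f≈g = +-cong (f≈g x) (sumOver-cong xs f≈g)

  sumOver-++ : {A : Set} (xs ys : List A) (f : A → Carrier) →
    sumOver (xs ++ ys) f ≈ sumOver xs f + sumOver ys f
  sumOver-++ []       ys f = sym (+-identityˡ _)
  sumOver-++ (x ∷ xs) ys f = trans (+-cong refl (sumOver-++ xs ys f)) (sym (+-assoc _ _ _))

  sumOver-map : {A B : Set} (g : A → B) (xs : List A) (f : B → Carrier) → sumOver (map g xs) f ≈ sumOver xs (f ∘ g)
  sumOver-map g []       f = refl
  sumOver-map g (x ∷ xs) f = +-cong refl (sumOver-map g xs f)

  sumOver-concatMap : {A B : Set} (g : A → List B) (xs : List A) (f : B → Carrier) →
    sumOver (concatMap g xs) f ≈ sumOver xs (λ x → sumOver (g x) f)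
  sumOver-concatMap g []       f = refl
  sumOver-concatMap g (x ∷ xs) f =
    trans (sumOver-++ (g x) (concatMap g xs) f) (+-cong refl (sumOver-concatMap g xs f))

  sumOver-zero : {A : Set} (xs : List A) {f : A → Carrier} → (∀ x → f x ≈ 0#) → sumOver xs f ≈ 0#
  sumOver-zero []       f≈0 = refl
  sumOver-zero (x ∷ xs) f≈0 = trans (+-cong (f≈0 x) (sumOver-zero xs f≈0)) (+-identityˡ 0#)

  sumOver-*ˡ : {A : Set} (xs : List A) (c : Carrier) (f : A → Carrier) →
    sumOver xs (λ x → c * f x) ≈ c * sumOver xs f
  sumOver-*ˡ []       c f = sym (zeroʳ c)
  sumOver-*ˡ (x ∷ xs) c f = trans (+-cong refl (sumOver-*ˡ xs c f)) (sym (distribˡ c _ _))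

  sumOver-[]· : {A : Set} (xs : List A) (p : Bool) (f : A → Carrier) →
    sumOver xs (λ x → [ p ]· f x) ≈ [ p ]· sumOver xs f
  sumOver-[]· xs true  f = refl
  sumOver-[]· xs false f = sumOver-zero xs (λ _ → refl)

  sumOver-filter : {A : Set} (p : A → Bool) (p? : ∀ x → Dec (T (p x))) (xs : List A) (f : A → Carrier) →
    sumOver (filter p? xs) f ≈ sumOver xs (λ x → [ p x ]· f x)
  sumOver-filter p p? []       f = refl
  sumOver-filter p p? (x ∷ xs) f with p? x
  ... | yes px  rewrite if-T  {x = f x} {y = 0#} px  = +-cong refl (sumOver-filter p p? xs f)
  ... | no  ¬px rewrite if-¬T {x = f x} {y = 0#} ¬px = trans (sumOver-filter p p? xs f) (sym (+-identityˡ _))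

  sumOver-applyUpTo-zero : (g : ℕ → ℕ) (f : ℕ → Carrier) (n : ℕ) → (∀ i → f (g i) ≈ 0#) →
    sumOver (applyUpTo g n) f ≈ 0#
  sumOver-applyUpTo-zero g f zero    vanish = refl
  sumOver-applyUpTo-zero g f (suc n) vanish =
    trans (+-cong (vanish 0) (sumOver-applyUpTo-zero (g ∘ suc) f n (vanish ∘ suc))) (+-identityˡ 0#)

  sumOver-applyUpTo-single : (g : ℕ → ℕ) (f : ℕ → Carrier) {n c : ℕ} → c < n →
    (∀ i → i ≢ c → f (g i) ≈ 0#) → sumOver (applyUpTo g n) f ≈ f (g c)
  sumOver-applyUpTo-single g f {suc n} {zero} _ vanish =
    trans (+-cong refl (sumOver-applyUpTo-zero (g ∘ suc) f n (λ i → vanish (suc i) λ ()))) (+-identityʳ _)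
  sumOver-applyUpTo-single g f {suc n} {suc c} (s≤s c<n) vanish =
    trans (+-cong (vanish 0 λ ())
                  (sumOver-applyUpTo-single (g ∘ suc) f c<n (λ i i≢c → vanish (suc i) (i≢c ∘ suc-injective))))
          (+-identityˡ _)

  sumOver-applyUpTo-pair : (g : ℕ → ℕ) (f : ℕ → Carrier) {n c d : ℕ} → c < n → d < n → c ≢ d →
    (∀ i → i ≢ c → i ≢ d → f (g i) ≈ 0#) → sumOver (applyUpTo g n) f ≈ f (g c) + f (g d)
  sumOver-applyUpTo-pair g f {c = zero} {zero} _ _ c≢d _ = ⊥-elim (c≢d ≡.refl)
  sumOver-applyUpTo-pair g f {suc n} {zero} {suc d} _ (s≤s d<n) _ vanish =
    +-cong refl (sumOver-applyUpTo-single (g ∘ suc) f d<n (λ i i≢d → vanish (suc i) (λ ()) (i≢d ∘ suc-injective)))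
  sumOver-applyUpTo-pair g f {suc n} {suc c} {zero} (s≤s c<n) _ _ vanish =
    trans (+-cong refl (sumOver-applyUpTo-single (g ∘ suc) f c<n
                         (λ i i≢c → vanish (suc i) (i≢c ∘ suc-injective) (λ ()))))
          (+-comm _ _)
  sumOver-applyUpTo-pair g f {suc n} {suc c} {suc d} (s≤s c<n) (s≤s d<n) c≢d vanish =
    trans (+-cong (vanish 0 (λ ()) (λ ()))
                  (sumOver-applyUpTo-pair (g ∘ suc) f c<n d<n (c≢d ∘ ≡.cong suc)
                    (λ i i≢c i≢d → vanish (suc i) (i≢c ∘ suc-injective) (i≢d ∘ suc-injective))))
          (+-identityˡ _)

  sumOver-lists-suc : (n N : ℕ) (f : List ℕ → Carrier) →
    sumOver (lists (suc n) N) f ≈ sumOver (upTo (suc N)) (λ x → sumOver (lists n N) (λ ys → f (x ∷ ys)))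
  sumOver-lists-suc n N f =
    trans (sumOver-concatMap (λ x → map (x ∷_) (lists n N)) (upTo (suc N)) f)
          (sumOver-cong (upTo (suc N)) (λ x → sumOver-map (x ∷_) (lists n N) f))

  sumOver-lists-cong : (n N : ℕ) {f g : List ℕ → Carrier} → (∀ ys → length ys ≡ n → f ys ≈ g ys) →
    sumOver (lists n N) f ≈ sumOver (lists n N) g
  sumOver-lists-cong zero    N f≈g = +-cong (f≈g [] ≡.refl) refl
  sumOver-lists-cong (suc n) N {f} {g} f≈g =
    trans (sumOver-lists-suc n N f)
      (trans (sumOver-cong (upTo (suc N)) (λ x → sumOver-lists-cong n N (λ ys len → f≈g (x ∷ ys) (≡.cong suc len))))
             (sym (sumOver-lists-suc n N g)))

module Powers {c ℓ : Level} (R : CommutativeRing c ℓ) where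
  open CommutativeRing R hiding (zero)
  open RingDefs R

  pow-+ : ∀ x m n → pow x (m +ℕ n) ≈ pow x m * pow x n
  pow-+ x zero    n = sym (*-identityˡ _)
  pow-+ x (suc m) n = trans (*-cong refl (pow-+ x m n)) (sym (*-assoc _ _ _))

  pow-merge : ∀ x m n {p} → m +ℕ n ≡ p → pow x m * pow x n ≈ pow x p
  pow-merge x m n ≡.refl = sym (pow-+ x m n)

module Gaussian {c ℓ : Level} (R : CommutativeRing c ℓ) where
  open CommutativeRing R hiding (zero)
  open RingDefs R
  open Powers R
  open import Algebra.Properties.Ring ring using (-‿distribʳ-*)
  open import Algebra.Solver.Ring.NaturalCoefficients.Default commutativeSemiring
    using (_:=_; _:*_; _:+_) renaming (solve to ring-solve)
  open import Relation.Binary.Reasoning.Setoid setoid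

  qBinom : Carrier → ℕ → ℕ → ℕ → Carrier
  qBinom q k n       zero    = 1#
  qBinom q k zero    (suc j) = 0#
  qBinom q k (suc n) (suc j) = qBinom q k n j + pow q (k *ℕ suc j) * qBinom q k n (suc j)

  qBinom-vanish : ∀ q k {n j} → n < j → qBinom q k n j ≈ 0#
  qBinom-vanish q k {zero}  {suc j} _         = refl
  qBinom-vanish q k {suc n} {suc j} (s≤s n<j) =
    trans (+-cong (qBinom-vanish q k n<j) (trans (*-cong refl (qBinom-vanish q k (m<n⇒m<1+n n<j))) (zeroʳ _)))
          (+-identityʳ 0#)

  one-minus-telescope : ∀ x y → (1# - x) + x * (1# - y) ≈ 1# - x * y
  one-minus-telescope x y = begin
    (1# - x) + x * (1# - y)   ≈⟨ +-cong refl (trans (distribˡ x 1# (- y))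
                                                    (+-cong (*-identityʳ x) (sym (-‿distribʳ-* x y)))) ⟩
    (1# - x) + (x - x * y)    ≈⟨ +-assoc 1# (- x) (x - x * y) ⟩
    1# + (- x + (x - x * y))  ≈⟨ +-cong refl (sym (+-assoc (- x) x (- (x * y)))) ⟩
    1# + ((- x + x) - x * y)  ≈⟨ +-cong refl (+-cong (-‿inverseˡ x) refl) ⟩
    1# + (0# - x * y)         ≈⟨ +-cong refl (+-identityˡ _) ⟩
    1# - x * y                ∎

  pascal-combine : ∀ {G₀ G₁ Q₁ Q₂ Pj Pr Pn} →
    G₀ * (Pj * (Pr * (1# - Q₂))) ≈ Pn → G₁ * ((Pj * (1# - Q₁)) * Pr) ≈ Pn →
    (G₀ + Q₁ * G₁) * ((Pj * (1# - Q₁)) * (Pr * (1# - Q₂))) ≈ Pn * (1# - Q₁ * Q₂)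
  pascal-combine {G₀} {G₁} {Q₁} {Q₂} {Pj} {Pr} {Pn} e₀ e₁ = begin
    (G₀ + Q₁ * G₁) * ((Pj * Y₁) * (Pr * Y₂))
      ≈⟨ expand G₀ G₁ Q₁ Pj Y₁ Pr Y₂ ⟩
    (G₀ * (Pj * (Pr * Y₂))) * Y₁ + (Q₁ * Y₂) * (G₁ * ((Pj * Y₁) * Pr))
      ≈⟨ +-cong (*-cong e₀ refl) (*-cong refl e₁) ⟩
    Pn * Y₁ + (Q₁ * Y₂) * Pn
      ≈⟨ factor Pn Y₁ Q₁ Y₂ ⟩
    Pn * (Y₁ + Q₁ * Y₂)
      ≈⟨ *-cong refl (one-minus-telescope Q₁ Q₂) ⟩
    Pn * (1# - Q₁ * Q₂) ∎
    where
    Y₁ Y₂ : Carrier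
    Y₁ = 1# - Q₁
    Y₂ = 1# - Q₂
    expand : ∀ G₀ G₁ Q₁ Pj Y₁ Pr Y₂ →
      (G₀ + Q₁ * G₁) * ((Pj * Y₁) * (Pr * Y₂))
        ≈ (G₀ * (Pj * (Pr * Y₂))) * Y₁ + (Q₁ * Y₂) * (G₁ * ((Pj * Y₁) * Pr))
    expand = ring-solve 7 (λ G₀ G₁ Q₁ Pj Y₁ Pr Y₂ →
      (G₀ :+ Q₁ :* G₁) :* ((Pj :* Y₁) :* (Pr :* Y₂))
        := (G₀ :* (Pj :* (Pr :* Y₂))) :* Y₁ :+ (Q₁ :* Y₂) :* (G₁ :* ((Pj :* Y₁) :* Pr))) refl
    factor : ∀ Pn Y₁ Q₁ Y₂ → Pn * Y₁ + (Q₁ * Y₂) * Pn ≈ Pn * (Y₁ + Q₁ * Y₂)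
    factor = ring-solve 4 (λ Pn Y₁ Q₁ Y₂ → Pn :* Y₁ :+ (Q₁ :* Y₂) :* Pn := Pn :* (Y₁ :+ Q₁ :* Y₂)) refl

  qBinom-qPoch : ∀ q k {n j} → j ≤ n → qBinom q k n j * (qPoch q k j * qPoch q k (n ∸ j)) ≈ qPoch q k n
  qBinom-qPoch q k {n}     {zero}  _         = trans (*-identityˡ _) (*-identityˡ _)
  qBinom-qPoch q k {suc n} {suc j} (s≤s j≤n) with m≤n⇒m<n∨m≡n j≤n
  ... | inj₂ ≡.refl = begin
    (qBinom q k n n + pow q (k *ℕ suc n) * qBinom q k n (suc n)) * ((qPoch q k n * Y) * qPoch q k (n ∸ n))
      ≈⟨ *-cong (trans (+-cong refl (trans (*-cong refl (qBinom-vanish q k (n<1+n n))) (zeroʳ _))) (+-identityʳ _)) refl ⟩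
    qBinom q k n n * ((qPoch q k n * Y) * qPoch q k (n ∸ n))
      ≈⟨ ring-solve 4 (λ G Pn Y Pr → G :* ((Pn :* Y) :* Pr) := (G :* (Pn :* Pr)) :* Y) refl _ _ _ _ ⟩
    (qBinom q k n n * (qPoch q k n * qPoch q k (n ∸ n))) * Y
      ≈⟨ *-cong (qBinom-qPoch q k {n} {n} ≤-refl) refl ⟩
    qPoch q k n * Y ∎
    where
    Y : Carrier
    Y = 1# - pow q (k *ℕ suc n)
  ... | inj₁ j<n = begin
    qBinom q k (suc n) (suc j) * (qPoch q k (suc j) * qPoch q k (n ∸ j))
      ≈⟨ *-cong refl (*-cong refl (reflexive (≡.cong (qPoch q k) n∸j≡1+r))) ⟩
    qBinom q k (suc n) (suc j) * (qPoch q k (suc j) * qPoch q k (suc r))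
      ≈⟨ pascal-combine below above ⟩
    qPoch q k n * (1# - pow q (k *ℕ suc j) * pow q (k *ℕ suc r))
      ≈⟨ *-cong refl (+-cong refl (-‿cong (pow-merge q (k *ℕ suc j) (k *ℕ suc r) exponent-sum))) ⟩
    qPoch q k (suc n) ∎
    where
    r : ℕ
    r = n ∸ suc j
    n∸j≡1+r : n ∸ j ≡ suc r
    n∸j≡1+r = +-∸-assoc 1 j<n
    below : qBinom q k n j * (qPoch q k j * qPoch q k (suc r)) ≈ qPoch q k n
    below = trans (*-cong refl (*-cong refl (reflexive (≡.cong (qPoch q k) (≡.sym n∸j≡1+r)))))
                  (qBinom-qPoch q k (<⇒≤ j<n))
    above : qBinom q k n (suc j) * (qPoch q k (suc j) * qPoch q k r) ≈ qPoch q k n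
    above = qBinom-qPoch q k j<n
    exponent-sum : k *ℕ suc j +ℕ k *ℕ suc r ≡ k *ℕ suc n
    exponent-sum = ≡.trans (≡.sym (ℕₚ.*-distribˡ-+ k (suc j) (suc r)))
                           (≡.cong (k *ℕ_) (≡.trans (ℕₚ.+-suc (suc j) r) (≡.cong suc (m+[n∸m]≡n j<n))))

module Validity (a b k′ : ℕ) where
  K : ℕ
  K = suc k′

  isA isB : ℕ → Bool
  isA x = x ≡[ K ]ᵇ a
  isB x = x ≡[ K ]ᵇ b

  legal : ℕ → Bool
  legal x = (1 ≤ᵇ x) ∧ (isA x ∨ isB x)

  repeatOK gapOK follows : ℕ → ℕ → Bool
  repeatOK x y = if x ≡ᵇ y then isB x else true
  gapOK    x y = if isB y then x ∸ y <ᵇ K else x ∸ y ≤ᵇ K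
  follows  x y = (y ≤ᵇ x) ∧ repeatOK x y ∧ gapOK x y

  isLast : ℕ → Bool
  isLast x = (x ≡ᵇ a) ∨ (x ≡ᵇ b)

  valid : List ℕ → Bool
  valid xs = allPos xs ∧ partsOK a b K xs ∧ adjOK a b K xs

  valid-∷-∷ : ∀ x y zs → valid (x ∷ y ∷ zs) ≡ (legal x ∧ follows x y) ∧ valid (y ∷ zs)
  valid-∷-∷ x y zs =
    ∧-shuffle (1 ≤ᵇ x) (isA x ∨ isB x) (y ≤ᵇ x) (repeatOK x y) (gapOK x y)
              (allPos (y ∷ zs)) (partsOK a b K (y ∷ zs)) (adjOK a b K (y ∷ zs))

  valid-[_] : ∀ x → valid (x ∷ []) ≡ legal x ∧ isLast x
  valid-[ x ] = ∧-true-shuffle (1 ≤ᵇ x) (isA x ∨ isB x) (isLast x)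

  valid⇒legal : ∀ x ys → T (valid (x ∷ ys)) → T (legal x)
  valid⇒legal x ys = T-∧-∧⇒T-∧ (1 ≤ᵇ x) (allPos ys) (isA x ∨ isB x) (partsOK a b K ys) (adjOK a b K (x ∷ ys))

  follows-isB : ∀ {x y} → T (isB y) → T (follows x y) ⇔ (y ≤ x × x < y +ℕ K)
  follows-isB {x} {y} yB = mk⇔ sound complete
    where
    sound : T (follows x y) → y ≤ x × x < y +ℕ K
    sound t with to (T-∧ {y ≤ᵇ x}) t
    ... | y≤ᵇx , rest with to (T-∧ {repeatOK x y}) rest
    ...   | _ , gap = ≤ᵇ⇒≤ y x y≤ᵇx , m∸n<o⇒m<n+o (<ᵇ⇒< (x ∸ y) K (≡.subst T (if-T yB) gap))
    complete : y ≤ x × x < y +ℕ K → T (follows x y)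
    complete (y≤x , x<y+K) =
      from T-∧ (≤⇒≤ᵇ y≤x , from T-∧ (T-if-≡ᵇ x y (λ { ≡.refl → yB }) ,
                                       ≡.subst T (≡.sym (if-T yB)) (<⇒<ᵇ (m<n+o⇒m∸n<o x y x<y+K))))

  follows-¬isB : ∀ {x y} → ¬ T (isB y) → T (follows x y) ⇔ (y < x × x ≤ y +ℕ K)
  follows-¬isB {x} {y} ¬yB = mk⇔ sound complete
    where
    sound : T (follows x y) → y < x × x ≤ y +ℕ K
    sound t with to (T-∧ {y ≤ᵇ x}) t
    ... | y≤ᵇx , rest with to (T-∧ {repeatOK x y}) rest
    ...   | repeat , gap =
      ≤∧≢⇒< (≤ᵇ⇒≤ y x y≤ᵇx) (λ { ≡.refl → ¬yB (T-if-≡ᵇ⁻ y y repeat ≡.refl) }) ,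
      m∸n≤o⇒m≤n+o (≤ᵇ⇒≤ (x ∸ y) K (≡.subst T (if-¬T ¬yB) gap))
    complete : y < x × x ≤ y +ℕ K → T (follows x y)
    complete (y<x , x≤y+K) =
      from T-∧ (≤⇒≤ᵇ (<⇒≤ y<x) , from T-∧ (T-if-≡ᵇ x y (λ { ≡.refl → ⊥-elim (<-irrefl ≡.refl y<x) }) ,
                                             ≡.subst T (≡.sym (if-¬T ¬yB)) (≤⇒≤ᵇ (m≤n+o⇒m∸n≤o x y x≤y+K))))

module Levels (a b k′ : ℕ) (1≤a : 1 ≤ a) (a<b : a < b) (b≤K : b ≤ suc k′) where
  open Validity a b k′

  aPart bPart : ℕ → ℕ
  aPart j = j *ℕ K +ℕ a
  bPart j = j *ℕ K +ℕ b

  aPart+K : ∀ i → aPart i +ℕ K ≡ aPart (suc i)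
  aPart+K i = level+K i K a

  bPart+K : ∀ i → bPart i +ℕ K ≡ bPart (suc i)
  bPart+K i = level+K i K b

  level-<-cancel : ∀ r {i j} → i *ℕ K +ℕ r < j *ℕ K +ℕ r → i < j
  level-<-cancel r {i} {j} lt = *-cancelʳ-< K i j (+-cancelʳ-< r (i *ℕ K) (j *ℕ K) lt)

  level-≤-cancel : ∀ r {i j} → i *ℕ K +ℕ r ≤ j *ℕ K +ℕ r → i ≤ j
  level-≤-cancel r {i} {j} le = *-cancelʳ-≤ i j K (+-cancelʳ-≤ r (i *ℕ K) (j *ℕ K) le)

  level-mono : ∀ r {i j} → i ≤ j → i *ℕ K +ℕ r ≤ j *ℕ K +ℕ r
  level-mono r i≤j = +-monoˡ-≤ r (*-monoˡ-≤ K i≤j)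

  aPart<bPart : ∀ i → aPart i < bPart i
  aPart<bPart i = +-monoʳ-< (i *ℕ K) a<b

  bPart<aPart-suc : ∀ i → bPart i < aPart (suc i)
  bPart<aPart-suc i = begin-strict
    i *ℕ K +ℕ b         <⟨ +-monoʳ-< (i *ℕ K) (≤-<-trans b≤K (m<n+m K 1≤a)) ⟩
    i *ℕ K +ℕ (a +ℕ K)  ≡⟨ ≡.sym (ℕₚ.+-assoc (i *ℕ K) a K) ⟩
    aPart i +ℕ K        ≡⟨ aPart+K i ⟩
    aPart (suc i)       ∎
    where open ℕₚ.≤-Reasoning

  aPart<aPart-suc : ∀ i → aPart i < aPart (suc i)
  aPart<aPart-suc i = <-trans (aPart<bPart i) (bPart<aPart-suc i)

  b<aPart-suc : ∀ j → b < aPart (suc j)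
  b<aPart-suc j = <-≤-trans (bPart<aPart-suc 0) (level-mono a {1} {suc j} (s≤s z≤n))

  b<bPart-suc : ∀ j → b < bPart (suc j)
  b<bPart-suc j = <-≤-trans (<-trans (bPart<aPart-suc 0) (aPart<bPart 1)) (level-mono b {1} {suc j} (s≤s z≤n))

  a<K : a < K
  a<K = <-≤-trans a<b b≤K

  a%K≢b%K : a % K ≢ b % K
  a%K≢b%K a≡b with m≤n⇒m<n∨m≡n b≤K
  ... | inj₁ b<K = <-irrefl (≡.trans (≡.sym (m<n⇒m%n≡m a<K)) (≡.trans a≡b (m<n⇒m%n≡m b<K))) a<b
  ... | inj₂ b≡K = <-irrefl (≡.sym (≡.trans (≡.sym (m<n⇒m%n≡m a<K))
                                            (≡.trans a≡b (≡.trans (≡.cong (_% K) b≡K) (n%n≡0 K)))))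
                            1≤a

  level-% : ∀ r j → (j *ℕ K +ℕ r) % K ≡ r % K
  level-% r j = ≡.trans (≡.cong (_% K) (ℕₚ.+-comm (j *ℕ K) r)) ([m+kn]%n≡m%n r j K)

  isA-aPart : ∀ j → T (isA (aPart j))
  isA-aPart j = ≡⇒≡ᵇ _ _ (level-% a j)

  ¬isB-aPart : ∀ j → ¬ T (isB (aPart j))
  ¬isB-aPart j t = a%K≢b%K (≡.trans (≡.sym (level-% a j)) (≡ᵇ⇒≡ _ _ t))

  isB-bPart : ∀ j → T (isB (bPart j))
  isB-bPart j = ≡⇒≡ᵇ _ _ (level-% b j)

  ¬isA-bPart : ∀ j → ¬ T (isA (bPart j))
  ¬isA-bPart j t = a%K≢b%K (≡.sym (≡.trans (≡.sym (level-% b j)) (≡ᵇ⇒≡ _ _ t)))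

  legal-aPart : ∀ j → T (legal (aPart j))
  legal-aPart j = from T-∧ (≤⇒≤ᵇ (≤-trans 1≤a (m≤n+m a (j *ℕ K))) , from T-∨ (inj₁ (isA-aPart j)))

  legal-bPart : ∀ j → T (legal (bPart j))
  legal-bPart j =
    from T-∧ (≤⇒≤ᵇ (≤-trans (<-≤-trans 1≤a (<⇒≤ a<b)) (m≤n+m b (j *ℕ K))) ,
              from T-∨ (inj₂ (isB-bPart j)))

  ≡-mod⇒level : ∀ r y → r ≤ K → 1 ≤ y → y % K ≡ r % K → ∃[ i ] y ≡ i *ℕ K +ℕ r
  ≡-mod⇒level r y r≤K 1≤y y≡r with m≤n⇒m<n∨m≡n r≤K
  ... | inj₁ r<K =
    y / K , ≡.trans (m≡m%n+[m/n]*n y K) (≡.trans (≡.cong (_+ℕ y / K *ℕ K) (≡.trans y≡r (m<n⇒m%n≡m r<K)))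
                                                (ℕₚ.+-comm r _))
  ... | inj₂ ≡.refl =
    multiple⇒level (y / K) (≡.trans (m≡m%n+[m/n]*n y K) (≡.cong (_+ℕ y / K *ℕ K) (≡.trans y≡r (n%n≡0 K))))
    where
    multiple⇒level : ∀ t → y ≡ t *ℕ K → ∃[ i ] y ≡ i *ℕ K +ℕ K
    multiple⇒level zero    y≡0 = ⊥-elim (<-irrefl (≡.sym y≡0) 1≤y)
    multiple⇒level (suc i) y≡t = i , ≡.trans y≡t (ℕₚ.+-comm K (i *ℕ K))

  legal-decode : ∀ y → T (legal y) → (∃[ i ] y ≡ aPart i) ⊎ (∃[ i ] y ≡ bPart i)
  legal-decode y t with to (T-∧ {1 ≤ᵇ y}) t
  ... | positive , kind with to (T-∨ {isA y}) kind
  ...   | inj₁ yA = inj₁ (≡-mod⇒level a y (<⇒≤ a<K) (≤ᵇ⇒≤ 1 y positive) (≡ᵇ⇒≡ _ _ yA))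
  ...   | inj₂ yB = inj₂ (≡-mod⇒level b y b≤K (≤ᵇ⇒≤ 1 y positive) (≡ᵇ⇒≡ _ _ yB))

  successors-aPart-suc : ∀ j y → T (legal y) → T (follows (aPart (suc j)) y) → y ≡ aPart j ⊎ y ≡ bPart j
  successors-aPart-suc j y legal-y f with legal-decode y legal-y
  ... | inj₁ (i , ≡.refl) = inj₁ (≡.cong aPart (≤-antisym (≤-pred i<1+j) (≤-pred 1+j≤1+i)))
    where
    bounds : aPart i < aPart (suc j) × aPart (suc j) ≤ aPart i +ℕ K
    bounds = to (follows-¬isB (¬isB-aPart i)) f
    i<1+j : i < suc j
    i<1+j = level-<-cancel a (proj₁ bounds)
    1+j≤1+i : suc j ≤ suc i
    1+j≤1+i = level-≤-cancel a (≤-trans (proj₂ bounds) (≤-reflexive (aPart+K i)))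
  ... | inj₂ (i , ≡.refl) = inj₂ (≡.cong bPart (≤-antisym i≤j j≤i))
    where
    bounds : bPart i ≤ aPart (suc j) × aPart (suc j) < bPart i +ℕ K
    bounds = to (follows-isB (isB-bPart i)) f
    i≤j : i ≤ j
    i≤j = ≤-pred (level-<-cancel b (≤-<-trans (proj₁ bounds) (aPart<bPart (suc j))))
    j≤i : j ≤ i
    j≤i = ≤-pred (≤-pred (level-<-cancel a (<-trans (<-≤-trans (proj₂ bounds) (≤-reflexive (bPart+K i)))
                                                    (bPart<aPart-suc (suc i)))))

  no-successor-aPart-zero : ∀ y → T (legal y) → ¬ T (follows (aPart 0) y)
  no-successor-aPart-zero y legal-y f with legal-decode y legal-y
  ... | inj₁ (i , ≡.refl) = n≮0 (level-<-cancel a {i} (proj₁ (to (follows-¬isB {y = aPart i} (¬isB-aPart i)) f)))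
  ... | inj₂ (i , ≡.refl) =
    n≮0 (level-<-cancel b {i} (≤-<-trans (proj₁ (to (follows-isB {y = bPart i} (isB-bPart i)) f)) (aPart<bPart 0)))

  successors-bPart : ∀ j y → T (legal y) → T (follows (bPart j) y) → y ≡ aPart j ⊎ y ≡ bPart j
  successors-bPart j y legal-y f with legal-decode y legal-y
  ... | inj₁ (i , ≡.refl) = inj₁ (≡.cong aPart (≤-antisym i≤j j≤i))
    where
    bounds : aPart i < bPart j × bPart j ≤ aPart i +ℕ K
    bounds = to (follows-¬isB (¬isB-aPart i)) f
    i≤j : i ≤ j
    i≤j = ≤-pred (level-<-cancel a (<-trans (proj₁ bounds) (bPart<aPart-suc j)))
    j≤i : j ≤ i
    j≤i = ≤-pred (level-<-cancel b (≤-<-trans (≤-trans (proj₂ bounds) (≤-reflexive (aPart+K i)))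
                                              (aPart<bPart (suc i))))
  ... | inj₂ (i , ≡.refl) = inj₂ (≡.cong bPart (≤-antisym i≤j j≤i))
    where
    bounds : bPart i ≤ bPart j × bPart j < bPart i +ℕ K
    bounds = to (follows-isB (isB-bPart i)) f
    i≤j : i ≤ j
    i≤j = level-≤-cancel b (proj₁ bounds)
    j≤i : j ≤ i
    j≤i = ≤-pred (level-<-cancel b (<-≤-trans (proj₂ bounds) (≤-reflexive (bPart+K i))))

  aPart-suc-follows-aPart : ∀ j → T (follows (aPart (suc j)) (aPart j))
  aPart-suc-follows-aPart j =
    from (follows-¬isB (¬isB-aPart j)) (aPart<aPart-suc j , ≤-reflexive (≡.sym (aPart+K j)))

  aPart-suc-follows-bPart : ∀ j → T (follows (aPart (suc j)) (bPart j))
  aPart-suc-follows-bPart j =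
    from (follows-isB (isB-bPart j))
         (<⇒≤ (bPart<aPart-suc j) , <-≤-trans (aPart<bPart (suc j)) (≤-reflexive (≡.sym (bPart+K j))))

  bPart-follows-aPart : ∀ j → T (follows (bPart j) (aPart j))
  bPart-follows-aPart j =
    from (follows-¬isB (¬isB-aPart j))
         (aPart<bPart j , ≤-trans (<⇒≤ (bPart<aPart-suc j)) (≤-reflexive (≡.sym (aPart+K j))))

  bPart-follows-bPart : ∀ j → T (follows (bPart j) (bPart j))
  bPart-follows-bPart j = from (follows-isB (isB-bPart j)) (≤-refl , m<m+n (bPart j) (s≤s z≤n))

  isLast-a : T (isLast a)
  isLast-a = from (T-∨ {a ≡ᵇ a}) (inj₁ (≡⇒≡ᵇ a a ≡.refl))

  isLast-b : T (isLast b)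
  isLast-b = from (T-∨ {b ≡ᵇ a}) (inj₂ (≡⇒≡ᵇ b b ≡.refl))

  ¬isLast-above-b : ∀ x → b < x → ¬ T (isLast x)
  ¬isLast-above-b x b<x t with to (T-∨ {x ≡ᵇ a}) t
  ... | inj₁ x≡ᵇa = <-irrefl (≡.sym (≡ᵇ⇒≡ x a x≡ᵇa)) (<-trans a<b b<x)
  ... | inj₂ x≡ᵇb = <-irrefl (≡.sym (≡ᵇ⇒≡ x b x≡ᵇb)) b<x

module GeneratingFunctions {c ℓ : Level} (R : CommutativeRing c ℓ) (a b k′ : ℕ) (u v q : CommutativeRing.Carrier R) where
  open CommutativeRing R hiding (zero)
  open RingDefs R
  open Sums R
  open Powers R
  open Validity a b k′
  open import Algebra.Solver.Ring.NaturalCoefficients.Default commutativeSemiring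
    using (_:=_; _:*_; con) renaming (solve to ring-solve)
  open import Relation.Binary.Reasoning.Setoid setoid

  W : List ℕ → Carrier
  W = weight a b K u v q

  partWeight : ℕ → Carrier
  partWeight x = pow u (if isA x then 1 else 0) * pow v (if isB x then 1 else 0) * pow q x

  weight-∷ : ∀ x ys → W (x ∷ ys) ≈ partWeight x * W ys
  weight-∷ x ys =
    trans (*-cong (*-cong (pow-+ u (if isA x then 1 else 0) (countMod K a ys))
                          (pow-+ v (if isB x then 1 else 0) (countMod K b ys)))
                  (pow-+ q x (size ys)))
          (regroup _ _ _ _ _ _)
    where
    regroup : ∀ U U′ V V′ Q Q′ → U * U′ * (V * V′) * (Q * Q′) ≈ U * V * Q * (U′ * V′ * Q′)
    regroup = ring-solve 6 (λ U U′ V V′ Q Q′ →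
      U :* U′ :* (V :* V′) :* (Q :* Q′) := U :* V :* Q :* (U′ :* V′ :* Q′)) refl

  weight-[_] : ∀ x → W (x ∷ []) ≈ partWeight x
  weight-[ x ] = trans (weight-∷ x []) (drop-ones (partWeight x))
    where
    drop-ones : ∀ X → X * (1# * 1# * 1#) ≈ X
    drop-ones = ring-solve 1 (λ X → X :* (con 1 :* con 1 :* con 1) := X) refl

  -- The weighted count of valid partitions with largest part x and n further parts; the
  -- enumeration bound N of `lists` loses nothing as long as x ≤ N.
  genFrom : ℕ → ℕ → ℕ → Carrier
  genFrom N n x = sumOver (lists n N) (λ ys → [ valid (x ∷ ys) ]· W (x ∷ ys))

  genFun≈genFrom : ∀ n N → genFun a b K (suc n) N u v q ≈ genFrom N n N
  genFun≈genFrom n N = begin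
    genFun a b K (suc n) N u v q
      ≈⟨ sumOver-filter (isBR'top a b K (suc n) N) _ (lists (suc n) N) W ⟩
    sumOver (lists (suc n) N) (λ xs → [ isBR'top a b K (suc n) N xs ]· W xs)
      ≈⟨ sumOver-lists-suc n N _ ⟩
    sumOver (upTo (suc N)) (λ x → sumOver (lists n N) (λ ys → [ isBR'top a b K (suc n) N (x ∷ ys) ]· W (x ∷ ys)))
      ≈⟨ sumOver-cong (upTo (suc N)) (λ x → sumOver-lists-cong n N (λ ys len → reflexive (top-condition x ys len))) ⟩
    sumOver (upTo (suc N)) (λ x → sumOver (lists n N) (λ ys → [ x ≡ᵇ N ]· [ valid (x ∷ ys) ]· W (x ∷ ys)))
      ≈⟨ sumOver-cong (upTo (suc N)) (λ x → sumOver-[]· (lists n N) (x ≡ᵇ N) _) ⟩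
    sumOver (upTo (suc N)) (λ x → [ x ≡ᵇ N ]· genFrom N n x)
      ≈⟨ sumOver-applyUpTo-single id _ (n<1+n N) (λ x x≢N → reflexive (if-¬T (x≢N ∘ ≡ᵇ⇒≡ x N))) ⟩
    [ N ≡ᵇ N ]· genFrom N n N
      ≡⟨ if-T (≡⇒≡ᵇ N N ≡.refl) ⟩
    genFrom N n N ∎
    where
    top-condition : ∀ x ys → length ys ≡ n →
      [ isBR'top a b K (suc n) N (x ∷ ys) ]· W (x ∷ ys) ≡ [ x ≡ᵇ N ]· [ valid (x ∷ ys) ]· W (x ∷ ys)
    top-condition x ys len =
      ≡.trans (≡.cong (λ p → [ p ]· W (x ∷ ys))
                      (≡.trans (≡.cong (_∧ (x ≡ᵇ N)) (T⇒∧-identityˡ (valid (x ∷ ys)) (≡⇒≡ᵇ _ _ len)))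
                               (∧-comm (valid (x ∷ ys)) (x ≡ᵇ N))))
              ([]·-∧ (x ≡ᵇ N) (valid (x ∷ ys)))

  genFrom-[] : ∀ N x → genFrom N 0 x ≈ [ legal x ∧ isLast x ]· partWeight x
  genFrom-[] N x =
    trans (+-identityʳ _) (trans (reflexive (≡.cong (λ p → [ p ]· W (x ∷ [])) valid-[ x ]))
                                 ([]·-cong (legal x ∧ isLast x) weight-[ x ]))

  genFrom-∷ : ∀ N n x →
    genFrom N (suc n) x ≈ sumOver (upTo (suc N)) (λ y → [ legal x ∧ follows x y ]· (partWeight x * genFrom N n y))
  genFrom-∷ N n x = begin
    genFrom N (suc n) x
      ≈⟨ sumOver-lists-suc n N _ ⟩
    sumOver (upTo (suc N)) (λ y → sumOver (lists n N) (λ zs → [ valid (x ∷ y ∷ zs) ]· W (x ∷ y ∷ zs)))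
      ≈⟨ sumOver-cong (upTo (suc N)) (λ y → sumOver-cong (lists n N) (split y)) ⟩
    sumOver (upTo (suc N)) (λ y → sumOver (lists n N) (λ zs → step y ([ valid (y ∷ zs) ]· W (y ∷ zs))))
      ≈⟨ sumOver-cong (upTo (suc N)) factor ⟩
    sumOver (upTo (suc N)) (λ y → step y (genFrom N n y)) ∎
    where
    step : ℕ → Carrier → Carrier
    step y t = [ legal x ∧ follows x y ]· (partWeight x * t)
    split : ∀ y zs → [ valid (x ∷ y ∷ zs) ]· W (x ∷ y ∷ zs) ≈ step y ([ valid (y ∷ zs) ]· W (y ∷ zs))
    split y zs = trans (reflexive (≡.cong (λ p → [ p ]· W (x ∷ y ∷ zs)) (valid-∷-∷ x y zs)))
                       (trans ([]·-cong ((legal x ∧ follows x y) ∧ valid (y ∷ zs)) (weight-∷ x (y ∷ zs)))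
                              ([]·-∧-* (legal x ∧ follows x y) (valid (y ∷ zs)) (partWeight x) (W (y ∷ zs))))
    factor : ∀ y → sumOver (lists n N) (λ zs → step y ([ valid (y ∷ zs) ]· W (y ∷ zs))) ≈ step y (genFrom N n y)
    factor y = trans (sumOver-[]· (lists n N) (legal x ∧ follows x y) _)
                     ([]·-cong (legal x ∧ follows x y) (sumOver-*ˡ (lists n N) (partWeight x) _))

  genFrom-illegal : ∀ N n x → ¬ T (legal x) → genFrom N n x ≈ 0#
  genFrom-illegal N n x ¬legal = sumOver-zero (lists n N) (λ ys → reflexive (if-¬T (¬legal ∘ valid⇒legal x ys)))

  successor-term-vanishes : ∀ N n x y → (T (legal y) → ¬ T (follows x y)) →
    [ legal x ∧ follows x y ]· (partWeight x * genFrom N n y) ≈ 0#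
  successor-term-vanishes N n x y excluded with T? (legal y)
  ... | yes legal-y = reflexive (if-¬T (excluded legal-y ∘ proj₂ ∘ to (T-∧ {legal x})))
  ... | no ¬legal-y = []·-zero (legal x ∧ follows x y) (trans (*-cong refl (genFrom-illegal N n y ¬legal-y)) (zeroʳ _))

  genFrom-no-successor : ∀ N n x → (∀ y → T (legal y) → ¬ T (follows x y)) → genFrom N (suc n) x ≈ 0#
  genFrom-no-successor N n x none =
    trans (genFrom-∷ N n x) (sumOver-applyUpTo-zero id _ (suc N) (λ y → successor-term-vanishes N n x y (none y)))

  genFrom-two-successors : ∀ N n x {y₁ y₂} → y₁ < suc N → y₂ < suc N → y₁ ≢ y₂ →
    T (legal x) → T (follows x y₁) → T (follows x y₂) →
    (∀ y → T (legal y) → T (follows x y) → y ≡ y₁ ⊎ y ≡ y₂) →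
    genFrom N (suc n) x ≈ partWeight x * (genFrom N n y₁ + genFrom N n y₂)
  genFrom-two-successors N n x {y₁} {y₂} y₁<N y₂<N y₁≢y₂ legal-x f₁ f₂ only = begin
    genFrom N (suc n) x
      ≈⟨ genFrom-∷ N n x ⟩
    sumOver (upTo (suc N)) term
      ≈⟨ sumOver-applyUpTo-pair id term y₁<N y₂<N y₁≢y₂ vanish ⟩
    term y₁ + term y₂
      ≈⟨ +-cong (kept {y₁} f₁) (kept {y₂} f₂) ⟩
    partWeight x * genFrom N n y₁ + partWeight x * genFrom N n y₂
      ≈⟨ sym (distribˡ _ _ _) ⟩
    partWeight x * (genFrom N n y₁ + genFrom N n y₂) ∎
    where
    term : ℕ → Carrier
    term y = [ legal x ∧ follows x y ]· (partWeight x * genFrom N n y)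
    kept : ∀ {y} → T (follows x y) → term y ≈ partWeight x * genFrom N n y
    kept f = reflexive (if-T (from (T-∧ {legal x}) (legal-x , f)))
    vanish : ∀ y → y ≢ y₁ → y ≢ y₂ → term y ≈ 0#
    vanish y y≢y₁ y≢y₂ = successor-term-vanishes N n x y (λ legal-y f → [ y≢y₁ , y≢y₂ ]′ (only y legal-y f))

module LevelRecurrences {c ℓ : Level} (R : CommutativeRing c ℓ) (a b k′ : ℕ) (1≤a : 1 ≤ a) (a<b : a < b)
                        (b≤K : b ≤ suc k′) (u v q : CommutativeRing.Carrier R) where
  open CommutativeRing R hiding (zero)
  open RingDefs R
  open Validity a b k′
  open Levels a b k′ 1≤a a<b b≤K
  open GeneratingFunctions R a b k′ u v q
  open import Algebra.Solver.Ring.NaturalCoefficients.Default commutativeSemiring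
    using (_:=_; _:*_; con) renaming (solve to ring-solve)

  partWeight-aPart : ∀ j → partWeight (aPart j) ≈ u * pow q (aPart j)
  partWeight-aPart j =
    trans (reflexive (≡.cong₂ (λ i i′ → pow u i * pow v i′ * pow q (aPart j))
                              (if-T (isA-aPart j)) (if-¬T (¬isB-aPart j))))
          (ring-solve 2 (λ U Q → U :* con 1 :* con 1 :* Q := U :* Q) refl u (pow q (aPart j)))

  partWeight-bPart : ∀ j → partWeight (bPart j) ≈ v * pow q (bPart j)
  partWeight-bPart j =
    trans (reflexive (≡.cong₂ (λ i i′ → pow u i * pow v i′ * pow q (bPart j))
                              (if-¬T (¬isA-bPart j)) (if-T (isB-bPart j))))
          (ring-solve 2 (λ V Q → con 1 :* (V :* con 1) :* Q := V :* Q) refl v (pow q (bPart j)))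

  genFrom-aPart-suc : ∀ N n j → bPart j < suc N →
    genFrom N (suc n) (aPart (suc j)) ≈ u * pow q (aPart (suc j)) * (genFrom N n (aPart j) + genFrom N n (bPart j))
  genFrom-aPart-suc N n j bj<N =
    trans (genFrom-two-successors N n (aPart (suc j)) (<-trans (aPart<bPart j) bj<N) bj<N (<⇒≢ (aPart<bPart j))
             (legal-aPart (suc j)) (aPart-suc-follows-aPart j) (aPart-suc-follows-bPart j) (successors-aPart-suc j))
          (*-cong (partWeight-aPart (suc j)) refl)

  genFrom-bPart : ∀ N n j → bPart j < suc N →
    genFrom N (suc n) (bPart j) ≈ v * pow q (bPart j) * (genFrom N n (aPart j) + genFrom N n (bPart j))
  genFrom-bPart N n j bj<N =
    trans (genFrom-two-successors N n (bPart j) (<-trans (aPart<bPart j) bj<N) bj<N (<⇒≢ (aPart<bPart j))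
             (legal-bPart j) (bPart-follows-aPart j) (bPart-follows-bPart j) (successors-bPart j))
          (*-cong (partWeight-bPart j) refl)

  genFrom-aPart-zero : ∀ N n → genFrom N (suc n) (aPart 0) ≈ 0#
  genFrom-aPart-zero N n = genFrom-no-successor N n (aPart 0) no-successor-aPart-zero

  genFrom-[a] : ∀ N → genFrom N 0 a ≈ u * pow q a
  genFrom-[a] N = trans (genFrom-[] N a)
                        (trans (reflexive (if-T (from (T-∧ {legal a}) (legal-aPart 0 , isLast-a)))) (partWeight-aPart 0))

  genFrom-[b] : ∀ N → genFrom N 0 b ≈ v * pow q b
  genFrom-[b] N = trans (genFrom-[] N b)
                        (trans (reflexive (if-T (from (T-∧ {legal b}) (legal-bPart 0 , isLast-b)))) (partWeight-bPart 0))

  genFrom-[]-above-b : ∀ N x → b < x → genFrom N 0 x ≈ 0#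
  genFrom-[]-above-b N x b<x =
    trans (genFrom-[] N x) (reflexive (if-¬T (¬isLast-above-b x b<x ∘ proj₂ ∘ to (T-∧ {legal x}))))

module ClosedForm {c ℓ : Level} (R : CommutativeRing c ℓ) (a b k′ : ℕ) (1≤a : 1 ≤ a) (a<b : a < b)
                  (b≤K : b ≤ suc k′) (u v q : CommutativeRing.Carrier R) where
  open CommutativeRing R hiding (zero)
  open RingDefs R
  open Powers R
  open Gaussian R
  open Validity a b k′
  open Levels a b k′ 1≤a a<b b≤K
  open GeneratingFunctions R a b k′ u v q
  open LevelRecurrences R a b k′ 1≤a a<b b≤K u v q
  open import Algebra.Solver.Ring.NaturalCoefficients.Default commutativeSemiring
    using (_:=_; _:*_; con) renaming (solve to ring-solve)
  open import Relation.Binary.Reasoning.Setoid setoid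

  S : Carrier
  S = u * pow q a + v * pow q b

  exponent : ℕ → ℕ → ℕ
  exponent n j = j *ℕ a +ℕ ((j +ℕ 1) C 2) *ℕ K +ℕ (n ∸ j) *ℕ b

  prefactor : ℕ → ℕ → Carrier
  prefactor n j = S * pow u j * pow v (n ∸ j) * pow q (exponent n j)

  closed : ℕ → ℕ → Carrier
  closed n j = prefactor n j * qBinom q K n j

  closed-vanish : ∀ {n j} → n < j → closed n j ≈ 0#
  closed-vanish n<j = trans (*-cong refl (qBinom-vanish q K n<j)) (zeroʳ _)

  closed-step-zero : ∀ n → v * pow q b * closed n 0 ≈ closed (suc n) 0
  closed-step-zero n =
    trans (regroup v (pow q b) S (pow v n) (pow q (n *ℕ b))) (*-cong (*-cong refl (pow-merge q b (n *ℕ b) ≡.refl)) refl)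
    where
    regroup : ∀ V Q S V′ Q′ → V * Q * (S * 1# * V′ * Q′ * 1#) ≈ S * 1# * (V * V′) * (Q * Q′) * 1#
    regroup = ring-solve 5 (λ V Q S V′ Q′ →
      V :* Q :* (S :* con 1 :* V′ :* Q′ :* con 1) := S :* con 1 :* (V :* V′) :* (Q :* Q′) :* con 1) refl

  closed-step-aPart : ∀ n j → u * pow q (aPart (suc j)) * closed n j ≈ prefactor (suc n) (suc j) * qBinom q K n j
  closed-step-aPart n j = begin
    u * pow q (aPart (suc j)) * closed n j
      ≈⟨ regroup u (pow q (aPart (suc j))) S (pow u j) (pow v (n ∸ j)) (pow q (exponent n j)) (qBinom q K n j) ⟩
    S * (u * pow u j) * pow v (n ∸ j) * (pow q (aPart (suc j)) * pow q (exponent n j)) * qBinom q K n j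
      ≈⟨ *-cong (*-cong refl (pow-merge q (aPart (suc j)) (exponent n j) (exponent-step-aPart a b K n j))) refl ⟩
    prefactor (suc n) (suc j) * qBinom q K n j ∎
    where
    regroup : ∀ U Q S U′ V Q′ G → U * Q * (S * U′ * V * Q′ * G) ≈ S * (U * U′) * V * (Q * Q′) * G
    regroup = ring-solve 7 (λ U Q S U′ V Q′ G →
      U :* Q :* (S :* U′ :* V :* Q′ :* G) := S :* (U :* U′) :* V :* (Q :* Q′) :* G) refl

  closed-step-bPart : ∀ n j → v * pow q (bPart (suc j)) * closed n (suc j)
                               ≈ prefactor (suc n) (suc j) * (pow q (K *ℕ suc j) * qBinom q K n (suc j))
  closed-step-bPart n j with suc j ≤? n
  ... | no j≮n = trans (*-cong refl (closed-vanish n<1+j)) (trans (zeroʳ _) (sym rhs≈0))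
    where
    n<1+j : n < suc j
    n<1+j = ≰⇒> j≮n
    rhs≈0 : prefactor (suc n) (suc j) * (pow q (K *ℕ suc j) * qBinom q K n (suc j)) ≈ 0#
    rhs≈0 = trans (*-cong refl (trans (*-cong refl (qBinom-vanish q K n<1+j)) (zeroʳ _))) (zeroʳ _)
  ... | yes j<n = begin
    v * pow q (bPart (suc j)) * closed n (suc j)
      ≈⟨ regroup v (pow q (bPart (suc j))) S (pow u (suc j)) (pow v (n ∸ suc j)) (pow q (exponent n (suc j)))
                 (qBinom q K n (suc j)) ⟩
    S * pow u (suc j) * (v * pow v (n ∸ suc j)) * (pow q (bPart (suc j)) * pow q (exponent n (suc j)))
      * qBinom q K n (suc j)
      ≈⟨ *-cong (*-cong (*-cong refl (reflexive (≡.cong (pow v) (≡.sym (+-∸-assoc 1 j<n)))))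
                        (trans (pow-merge q (bPart (suc j)) (exponent n (suc j)) (exponent-step-bPart a b K n j j<n))
                               (pow-+ q (exponent (suc n) (suc j)) (K *ℕ suc j))))
                refl ⟩
    S * pow u (suc j) * pow v (n ∸ j) * (pow q (exponent (suc n) (suc j)) * pow q (K *ℕ suc j))
      * qBinom q K n (suc j)
      ≈⟨ reassociate (S * pow u (suc j) * pow v (n ∸ j)) (pow q (exponent (suc n) (suc j))) (pow q (K *ℕ suc j))
                     (qBinom q K n (suc j)) ⟩
    prefactor (suc n) (suc j) * (pow q (K *ℕ suc j) * qBinom q K n (suc j)) ∎
    where
    regroup : ∀ V Q S U V′ Q′ G → V * Q * (S * U * V′ * Q′ * G) ≈ S * U * (V * V′) * (Q * Q′) * G
    regroup = ring-solve 7 (λ V Q S U V′ Q′ G →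
      V :* Q :* (S :* U :* V′ :* Q′ :* G) := S :* U :* (V :* V′) :* (Q :* Q′) :* G) refl
    reassociate : ∀ X Q Q′ G → X * (Q * Q′) * G ≈ X * Q * (Q′ * G)
    reassociate = ring-solve 4 (λ X Q Q′ G → X :* (Q :* Q′) :* G := X :* Q :* (Q′ :* G)) refl

  closed-step : ∀ n j →
    u * pow q (aPart (suc j)) * closed n j + v * pow q (bPart (suc j)) * closed n (suc j) ≈ closed (suc n) (suc j)
  closed-step n j = trans (+-cong (closed-step-aPart n j) (closed-step-bPart n j)) (sym (distribˡ _ _ _))

  genFrom-pair-closed : ∀ N n j → bPart j < suc N → genFrom N n (aPart j) + genFrom N n (bPart j) ≈ closed n j
  genFrom-pair-closed N zero zero _ =
    trans (+-cong (genFrom-[a] N) (genFrom-[b] N)) (ring-solve 1 (λ S → S := S :* con 1 :* con 1 :* con 1 :* con 1) refl S)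
  genFrom-pair-closed N zero (suc j) _ =
    trans (+-cong (genFrom-[]-above-b N _ (b<aPart-suc j)) (genFrom-[]-above-b N _ (b<bPart-suc j)))
          (trans (+-identityʳ 0#) (sym (zeroʳ _)))
  genFrom-pair-closed N (suc n) zero b<N = begin
    genFrom N (suc n) (aPart 0) + genFrom N (suc n) (bPart 0)
      ≈⟨ +-cong (genFrom-aPart-zero N n) (genFrom-bPart N n 0 b<N) ⟩
    0# + v * pow q b * (genFrom N n (aPart 0) + genFrom N n (bPart 0))
      ≈⟨ trans (+-identityˡ _) (*-cong refl (genFrom-pair-closed N n 0 b<N)) ⟩
    v * pow q b * closed n 0
      ≈⟨ closed-step-zero n ⟩
    closed (suc n) 0 ∎
  genFrom-pair-closed N (suc n) (suc j) bj<N = begin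
    genFrom N (suc n) (aPart (suc j)) + genFrom N (suc n) (bPart (suc j))
      ≈⟨ +-cong (genFrom-aPart-suc N n j bj′<N) (genFrom-bPart N n (suc j) bj<N) ⟩
    u * pow q (aPart (suc j)) * (genFrom N n (aPart j) + genFrom N n (bPart j))
      + v * pow q (bPart (suc j)) * (genFrom N n (aPart (suc j)) + genFrom N n (bPart (suc j)))
      ≈⟨ +-cong (*-cong refl (genFrom-pair-closed N n j bj′<N)) (*-cong refl (genFrom-pair-closed N n (suc j) bj<N)) ⟩
    u * pow q (aPart (suc j)) * closed n j + v * pow q (bPart (suc j)) * closed n (suc j)
      ≈⟨ closed-step n j ⟩
    closed (suc n) (suc j) ∎
    where
    bj′<N : bPart j < suc N
    bj′<N = <-trans (<-trans (bPart<aPart-suc j) (aPart<bPart (suc j))) bj<N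

  genFun-aPart-top : ∀ n h → genFun a b K (suc (suc n)) (aPart (suc h)) u v q ≈ u * pow q (aPart (suc h)) * closed n h
  genFun-aPart-top n h = begin
    genFun a b K (suc (suc n)) N u v q
      ≈⟨ genFun≈genFrom (suc n) N ⟩
    genFrom N (suc n) (aPart (suc h))
      ≈⟨ genFrom-aPart-suc N n h bh<N ⟩
    u * pow q N * (genFrom N n (aPart h) + genFrom N n (bPart h))
      ≈⟨ *-cong refl (genFrom-pair-closed N n h bh<N) ⟩
    u * pow q N * closed n h ∎
    where
    N : ℕ
    N = aPart (suc h)
    bh<N : bPart h < suc N
    bh<N = <-trans (bPart<aPart-suc h) (n<1+n N)

  genFun-bPart-top : ∀ n h → genFun a b K (suc (suc n)) (bPart h) u v q ≈ v * pow q (bPart h) * closed n h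
  genFun-bPart-top n h = begin
    genFun a b K (suc (suc n)) N u v q
      ≈⟨ genFun≈genFrom (suc n) N ⟩
    genFrom N (suc n) (bPart h)
      ≈⟨ genFrom-bPart N n h (n<1+n N) ⟩
    v * pow q N * (genFrom N n (aPart h) + genFrom N n (bPart h))
      ≈⟨ *-cong refl (genFrom-pair-closed N n h (n<1+n N)) ⟩
    v * pow q N * closed n h ∎
    where
    N : ℕ
    N = bPart h

  theorem-aPart-top : ∀ n h → h ≤ n →
    genFun a b K (suc (suc n)) (K *ℕ (h +ℕ 1) +ℕ a) u v q * (qPoch q K h * qPoch q K (suc (suc n) ∸ 2 ∸ h))
      ≈ (u * pow q a + v * pow q b) * pow u (h +ℕ 1) * pow v (suc (suc n) ∸ h ∸ 2)
          * pow q ((suc (suc n) ∸ 1) *ℕ b +ℕ K *ℕ ((h +ℕ 1) C 2) +ℕ (K ∸ b +ℕ a) *ℕ (h +ℕ 1))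
          * qPoch q K (suc (suc n) ∸ 2)
  theorem-aPart-top n h h≤n = begin
    genFun a b K (suc (suc n)) (K *ℕ (h +ℕ 1) +ℕ a) u v q * P
      ≡⟨ ≡.cong (λ N → genFun a b K (suc (suc n)) N u v q * P) top≡aPart ⟩
    genFun a b K (suc (suc n)) (aPart (suc h)) u v q * P
      ≈⟨ *-cong (genFun-aPart-top n h) refl ⟩
    u * pow q (aPart (suc h)) * closed n h * P
      ≈⟨ regroup u (pow q (aPart (suc h))) S (pow u h) (pow v (n ∸ h)) (pow q (exponent n h)) (qBinom q K n h) P ⟩
    S * pow u (suc h) * pow v (n ∸ h) * (pow q (aPart (suc h)) * pow q (exponent n h)) * (qBinom q K n h * P)
      ≈⟨ *-cong (*-cong (*-cong (*-cong refl (reflexive (≡.cong (pow u) (ℕₚ.+-comm 1 h))))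
                                (reflexive (≡.cong (pow v) (≡.sym v-index))))
                        (pow-merge q (aPart (suc h)) (exponent n h) (≡.sym (exponent-top-aPart a b K n h b≤K h≤n))))
                (qBinom-qPoch q K h≤n) ⟩
    S * pow u (h +ℕ 1) * pow v (suc (suc n) ∸ h ∸ 2)
      * pow q (suc n *ℕ b +ℕ K *ℕ ((h +ℕ 1) C 2) +ℕ (K ∸ b +ℕ a) *ℕ (h +ℕ 1)) * qPoch q K n ∎
    where
    P : Carrier
    P = qPoch q K h * qPoch q K (n ∸ h)
    top≡aPart : K *ℕ (h +ℕ 1) +ℕ a ≡ aPart (suc h)
    top≡aPart = ≡.cong (_+ℕ a) (≡.trans (ℕₚ.*-comm K (h +ℕ 1)) (≡.cong (_*ℕ K) (ℕₚ.+-comm h 1)))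
    v-index : suc (suc n) ∸ h ∸ 2 ≡ n ∸ h
    v-index = ≡.trans (∸-+-assoc (suc (suc n)) h 2) (≡.cong (suc (suc n) ∸_) (ℕₚ.+-comm h 2))
    regroup : ∀ U Q S U′ V Q′ G P → U * Q * (S * U′ * V * Q′ * G) * P ≈ S * (U * U′) * V * (Q * Q′) * (G * P)
    regroup = ring-solve 8 (λ U Q S U′ V Q′ G P →
      U :* Q :* (S :* U′ :* V :* Q′ :* G) :* P := S :* (U :* U′) :* V :* (Q :* Q′) :* (G :* P)) refl

  theorem-bPart-top : ∀ n h → h ≤ n →
    genFun a b K (suc (suc n)) (K *ℕ h +ℕ b) u v q * (qPoch q K h * qPoch q K (suc (suc n) ∸ 2 ∸ h))
      ≈ (u * pow q a + v * pow q b) * pow u h * pow v (suc (suc n) ∸ h ∸ 1)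
          * pow q ((suc (suc n) ∸ 1) *ℕ b +ℕ K *ℕ ((h +ℕ 1) C 2) +ℕ (K ∸ b +ℕ a) *ℕ h)
          * qPoch q K (suc (suc n) ∸ 2)
  theorem-bPart-top n h h≤n = begin
    genFun a b K (suc (suc n)) (K *ℕ h +ℕ b) u v q * P
      ≡⟨ ≡.cong (λ N → genFun a b K (suc (suc n)) (N +ℕ b) u v q * P) (ℕₚ.*-comm K h) ⟩
    genFun a b K (suc (suc n)) (bPart h) u v q * P
      ≈⟨ *-cong (genFun-bPart-top n h) refl ⟩
    v * pow q (bPart h) * closed n h * P
      ≈⟨ regroup v (pow q (bPart h)) S (pow u h) (pow v (n ∸ h)) (pow q (exponent n h)) (qBinom q K n h) P ⟩
    S * pow u h * pow v (suc (n ∸ h)) * (pow q (bPart h) * pow q (exponent n h)) * (qBinom q K n h * P)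
      ≈⟨ *-cong (*-cong (*-cong refl (reflexive (≡.cong (pow v) (≡.sym v-index))))
                        (pow-merge q (bPart h) (exponent n h) (≡.sym (exponent-top-bPart a b K n h b≤K h≤n))))
                (qBinom-qPoch q K h≤n) ⟩
    S * pow u h * pow v (suc (suc n) ∸ h ∸ 1)
      * pow q (suc n *ℕ b +ℕ K *ℕ ((h +ℕ 1) C 2) +ℕ (K ∸ b +ℕ a) *ℕ h) * qPoch q K n ∎
    where
    P : Carrier
    P = qPoch q K h * qPoch q K (n ∸ h)
    v-index : suc (suc n) ∸ h ∸ 1 ≡ suc (n ∸ h)
    v-index = ≡.trans (∸-+-assoc (suc (suc n)) h 1)
                      (≡.trans (≡.cong (suc (suc n) ∸_) (ℕₚ.+-comm h 1)) (+-∸-assoc 1 h≤n))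
    regroup : ∀ V Q S U V′ Q′ G P → V * Q * (S * U * V′ * Q′ * G) * P ≈ S * U * (V * V′) * (Q * Q′) * (G * P)
    regroup = ring-solve 8 (λ V Q S U V′ Q′ G P →
      V :* Q :* (S :* U :* V′ :* Q′ :* G) :* P := S :* U :* (V :* V′) :* (Q :* Q′) :* (G :* P)) refl

mainTheorem11 : {c ℓ : Level} (R : CommutativeRing c ℓ) →
    let open CommutativeRing R
        open RingDefs R
    in (a b k m h : ℕ) → 1 ≤ a → a < b → b ≤ k → 2 ≤ m → h ≤ m ∸ 2 →
       (u v q : Carrier) →
       (genFun a b k m (k *ℕ (h +ℕ 1) +ℕ a) u v q * (qPoch q k h * qPoch q k (m ∸ 2 ∸ h))
          ≈ (u * pow q a + v * pow q b) * pow u (h +ℕ 1) * pow v (m ∸ h ∸ 2)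
              * pow q ((m ∸ 1) *ℕ b +ℕ k *ℕ ((h +ℕ 1) C 2) +ℕ (k ∸ b +ℕ a) *ℕ (h +ℕ 1))
              * qPoch q k (m ∸ 2))
       × (genFun a b k m (k *ℕ h +ℕ b) u v q * (qPoch q k h * qPoch q k (m ∸ 2 ∸ h))
          ≈ (u * pow q a + v * pow q b) * pow u h * pow v (m ∸ h ∸ 1)
              * pow q ((m ∸ 1) *ℕ b +ℕ k *ℕ ((h +ℕ 1) C 2) +ℕ (k ∸ b +ℕ a) *ℕ h)
              * qPoch q k (m ∸ 2))
mainTheorem11 R a b zero m h 1≤a a<b b≤0 _ _ u v q = ⊥-elim (n≮0 (<-≤-trans a<b b≤0))
mainTheorem11 R a b (suc k′) (suc (suc n)) h 1≤a a<b b≤k (s≤s (s≤s z≤n)) h≤n u v q =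
  theorem-aPart-top n h h≤n , theorem-bPart-top n h h≤n
  where open ClosedForm R a b k′ 1≤a a<b b≤k u v q
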